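{- Let $d\ge 1$ and $t\ge 1$ be integers, and suppose $G$ is a cograph of depth at most $d$ that does not contain $K_{t,t}$ as an induced subgraph. Then the subchromatic number of $G$ is at most $1+(d-1)(t-1)$.
   Context: A cotree of a graph $G$ is a rooted tree $T$ whose leaf set is $V(G)$ and whose non-leaf nodes are each designated a join node or a union node, such that two distinct vertices $u,v$ are adjacent in $G$ iff their lowest common ancestor in $T$ is a join node. The depth of $T$ is the maximum number of nodes on a root-to-leaf path. $G$ is a cograph of depth at most $d$ if it admits a cotree of depth at most $d$. A cluster graph is a graph whose every component is a clique; a subcoloring of $G$ is a map $\lambda\colon V(G)\to C$ with $G[\lambda^{ -1}(i)]$ a cluster graph for each $i$; the subchromatic number is the minimum number of colors of a subcoloring. -}

module Defs where

open import Data.Nat using (ℕ; zero; suc; _⊔_; _≤_; _+_; _*_; _∸_)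
open import Data.Fin using (Fin)
open import Data.List using (List; []; _∷_; length; lookup; concat; map; allFin)
open import Data.List.Relation.Unary.Any using (Any)
open import Data.List.Membership.Propositional using (_∈_)
open import Data.List.Relation.Binary.Permutation.Propositional using (_↭_)
open import Data.Product using (Σ; _×_; ∃; ∃-syntax)
open import Relation.Binary.PropositionalEquality using (_≡_; _≢_)
open import Relation.Nullary using (¬_)
open import Function.Bundles using (_⇔_)

record Graph (n : ℕ) : Set₁ where
  field
    E     : Fin n → Fin n → Set
    sym   : ∀ {u v} → E u v → E v u
    irrefl : ∀ {u} → ¬ E u u
open Graph public

data Kind : Set where
  join union : Kind

data Cotree (n : ℕ) : Set where
  leaf : Fin n → Cotree n
  node : Kind → List (Cotree n) → Cotree n

mutual
  leaves : ∀ {n} → Cotree n → List (Fin n)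
  leaves (leaf v) = v ∷ []
  leaves (node _ cs) = leavesL cs

  leavesL : ∀ {n} → List (Cotree n) → List (Fin n)
  leavesL [] = []
  leavesL (c ∷ cs) = leaves c Data.List.++ leavesL cs

mutual
  depth : ∀ {n} → Cotree n → ℕ
  depth (leaf _) = 1
  depth (node _ cs) = suc (depthL cs)

  depthL : ∀ {n} → List (Cotree n) → ℕ
  depthL [] = 0
  depthL (c ∷ cs) = depth c ⊔ depthL cs

-- LcaJoin T u v : the lowest common ancestor of leaves u and v in T is a join node.
-- (Given that every vertex occurs exactly once as a leaf, the lca of u ≠ v is the
-- unique node at which u and v lie in different children.)
data LcaJoin {n : ℕ} : Cotree n → Fin n → Fin n → Set where
  here  : ∀ {cs u v} (i j : Fin (length cs)) → i ≢ j →
          u ∈ leaves (lookup cs i) → v ∈ leaves (lookup cs j) →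
          LcaJoin (node join cs) u v
  there : ∀ {k cs u v} → Any (λ c → LcaJoin c u v) cs →
          LcaJoin (node k cs) u v

IsCotree : ∀ {n} → Graph n → Cotree n → Set
IsCotree {n} G T =
  (leaves T ↭ allFin n) ×
  (∀ u v → u ≢ v → (E G u v ⇔ LcaJoin T u v))

CographOfDepthAtMost : ℕ → ∀ {n} → Graph n → Set
CographOfDepthAtMost d G = ∃[ T ] (IsCotree G T × depth T ≤ d)

ContainsInducedKtt : ℕ → ∀ {n} → Graph n → Set
ContainsInducedKtt t {n} G =
  Σ (Fin t → Fin n) λ a → Σ (Fin t → Fin n) λ b →
    (∀ i j → a i ≡ a j → i ≡ j) ×
    (∀ i j → b i ≡ b j → i ≡ j) ×
    (∀ i j → a i ≢ b j) ×
    (∀ i j → i ≢ j → ¬ E G (a i) (a j)) ×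
    (∀ i j → i ≢ j → ¬ E G (b i) (b j)) ×
    (∀ i j → E G (a i) (b j))

data ConnIn {n} (G : Graph n) (P : Fin n → Set) : Fin n → Fin n → Set where
  refl : ∀ {u} → P u → ConnIn G P u u
  step : ∀ {u v w} → P u → E G u v → ConnIn G P v w → ConnIn G P u w

IsClusterGraphOn : ∀ {n} → Graph n → (Fin n → Set) → Set
IsClusterGraphOn G P = ∀ u v → u ≢ v → ConnIn G P u v → E G u v

IsSubcoloring : ∀ {n k} → Graph n → (Fin n → Fin k) → Set
IsSubcoloring G col = ∀ i → IsClusterGraphOn G (λ v → col v ≡ i)

SubchromaticAtMost : ℕ → ∀ {n} → Graph n → Set
SubchromaticAtMost k {n} G = Σ (Fin n → Fin k) λ col → IsSubcoloring G col

{-# OPTIONS --safe #-}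
module Submission where

-- For a subtree S, α S (1 at a leaf, the sum over the children of
-- a union node, the maximum at a join node) is the independence number of its cograph, and the
-- leaves of S split into α S cliques. A union node colours all its children from one palette.
-- At a join node at most one child has α ≥ t, since two such children span an induced K_{t,t};
-- that child is coloured recursively with 1 + (d - 2)(t - 1) colours, and every other child is
-- split into at most t - 1 cliques sharing t - 1 fresh colours. Each fresh colour class is a
-- clique, as distinct children of a join node are completely joined.

open import Defs hiding (sym)
open import Data.Bool using (if_then_else_)
open import Data.Empty using (⊥-elim)
open import Data.Fin as Fin using (Fin; zero; suc)
import Data.Fin.Properties as Fin
open import Data.List using (List; []; _∷_; _++_; length; lookup)
open import Data.List.Properties using (length-++)
open import Data.List.Membership.Propositional using (_∈_; _∉_; lose)
open import Data.List.Membership.Propositional.Properties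
  using (∈-++⁺ˡ; ∈-++⁺ʳ; ∈-++⁻; ∈-lookup; ∈-allFin)
open import Data.List.Relation.Binary.Disjoint.Propositional using (Disjoint)
open import Data.List.Relation.Binary.Permutation.Propositional using (↭-sym; ↭⇒↭ₛ)
open import Data.List.Relation.Binary.Permutation.Propositional.Properties using (∈-resp-↭)
open import Data.List.Relation.Binary.Subset.Propositional using (_⊆_)
import Data.List.Relation.Unary.All as All
import Data.List.Relation.Unary.All.Properties as All
open import Data.List.Relation.Unary.Any using (Any; here; there; index)
open import Data.List.Relation.Unary.Any.Properties using (lookup-index)
open import Data.List.Relation.Unary.Unique.Propositional using (Unique; []; _∷_)
import Data.List.Relation.Unary.Unique.Propositional.Properties as Unique
open import Data.Nat using (ℕ; suc; _≤_; _<_; _+_; _*_; _∸_; _⊔_; z≤n; s≤s; _≤?_)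
open import Data.Nat.Properties
open import Data.Product as Product using (∃; _×_; _,_; proj₁; proj₂)
open import Data.Sum using (_⊎_; inj₁; inj₂; [_,_]′)
open import Function using (_∘_; id)
open import Function.Bundles using (Equivalence)
open import Relation.Binary.PropositionalEquality
  using (_≡_; _≢_; refl; sym; trans; cong; subst; setoid)
open import Relation.Nullary using (¬_; yes; no; does)
open import Relation.Nullary.Decidable using (decidable-stable)

Unique-++⁻ : ∀ {A : Set} (xs : List A) {ys : List A} →
             Unique (xs ++ ys) → Unique xs × Unique ys × Disjoint xs ys
Unique-++⁻ []       u-ys = [] , u-ys , λ ()
Unique-++⁻ (x ∷ xs) (x∉ ∷ u) with Unique-++⁻ xs u
... | u-xs , u-ys , xs#ys = All.++⁻ˡ xs x∉ ∷ u-xs , u-ys , disjoint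
  where
  disjoint : Disjoint (x ∷ xs) _
  disjoint (here refl  , v∈ys) = All.lookup x∉ (∈-++⁺ʳ xs v∈ys) refl
  disjoint (there v∈xs , v∈ys) = xs#ys (v∈xs , v∈ys)

Unique⇒lookup-injective : ∀ {A : Set} {xs : List A} → Unique xs →
                          ∀ i j → lookup xs i ≡ lookup xs j → i ≡ j
Unique⇒lookup-injective (_  ∷ _) zero    zero    _  = refl
Unique⇒lookup-injective (x∉ ∷ _) zero    (suc j) eq = ⊥-elim (All.lookup x∉ (∈-lookup j) eq)
Unique⇒lookup-injective (x∉ ∷ _) (suc i) zero    eq = ⊥-elim (All.lookup x∉ (∈-lookup i) (sym eq))
Unique⇒lookup-injective (_  ∷ u) (suc i) (suc j) eq = cong suc (Unique⇒lookup-injective u i j eq)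

∈-++-∉ˡ : ∀ {A : Set} {x : A} xs {ys} → x ∈ xs ++ ys → x ∉ xs → x ∈ ys
∈-++-∉ˡ xs x∈ x∉ = [ ⊥-elim ∘ x∉ , id ]′ (∈-++⁻ xs x∈)

module _ {n : ℕ} where
  open import Data.List.Membership.DecPropositional (Fin._≟_ {n}) using (_∈?_)

  ∈-leavesL⁺ : ∀ cs (i : Fin (length cs)) {v} → v ∈ leaves (lookup cs i) → v ∈ leavesL {n} cs
  ∈-leavesL⁺ (c ∷ cs) zero    v∈ = ∈-++⁺ˡ v∈
  ∈-leavesL⁺ (c ∷ cs) (suc i) v∈ = ∈-++⁺ʳ (leaves c) (∈-leavesL⁺ cs i v∈)

  ∈-leavesL⁻ : ∀ cs {v} → v ∈ leavesL {n} cs → ∃ λ i → v ∈ leaves (lookup cs i)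
  ∈-leavesL⁻ (c ∷ cs) v∈ with ∈-++⁻ (leaves c) v∈
  ... | inj₁ v∈c  = zero , v∈c
  ... | inj₂ v∈cs with ∈-leavesL⁻ cs v∈cs
  ...   | i , v∈i = suc i , v∈i

  head-unique : ∀ c cs → Unique (leavesL {n} (c ∷ cs)) → Unique (leaves c)
  head-unique c _ = proj₁ ∘ Unique-++⁻ (leaves c)

  tail-unique : ∀ c cs → Unique (leavesL {n} (c ∷ cs)) → Unique (leavesL cs)
  tail-unique c _ = proj₁ ∘ proj₂ ∘ Unique-++⁻ (leaves c)

  head#tail : ∀ c cs → Unique (leavesL {n} (c ∷ cs)) → Disjoint (leaves c) (leavesL cs)
  head#tail c _ = proj₂ ∘ proj₂ ∘ Unique-++⁻ (leaves c)

  childIndex-unique : ∀ cs → Unique (leavesL {n} cs) → ∀ {i j v} →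
                      v ∈ leaves (lookup cs i) → v ∈ leaves (lookup cs j) → i ≡ j
  childIndex-unique (c ∷ cs) un {zero}  {zero}  _   _   = refl
  childIndex-unique (c ∷ cs) un {zero}  {suc j} v∈c v∈j =
    ⊥-elim (head#tail c cs un (v∈c , ∈-leavesL⁺ cs j v∈j))
  childIndex-unique (c ∷ cs) un {suc i} {zero}  v∈i v∈c =
    ⊥-elim (head#tail c cs un (v∈c , ∈-leavesL⁺ cs i v∈i))
  childIndex-unique (c ∷ cs) un {suc i} {suc j} v∈i v∈j =
    cong suc (childIndex-unique cs (tail-unique c cs un) v∈i v∈j)

  child-unique : ∀ cs → Unique (leavesL {n} cs) → ∀ i → Unique (leaves (lookup cs i))
  child-unique (c ∷ cs) un zero    = head-unique c cs un
  child-unique (c ∷ cs) un (suc i) = child-unique cs (tail-unique c cs un) i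

  depth-lookup : ∀ cs (i : Fin (length cs)) → depth {n} (lookup cs i) ≤ depthL cs
  depth-lookup (c ∷ cs) zero    = m≤m⊔n (depth c) (depthL cs)
  depth-lookup (c ∷ cs) (suc i) = ≤-trans (depth-lookup cs i) (m≤n⊔m (depth c) (depthL cs))

  depth≥1 : ∀ (S : Cotree n) → 1 ≤ depth S
  depth≥1 (leaf _)   = s≤s z≤n
  depth≥1 (node _ _) = s≤s z≤n

  mutual
    LcaJoin⇒∈ : ∀ {S : Cotree n} {u v} → LcaJoin S u v → u ∈ leaves S × v ∈ leaves S
    LcaJoin⇒∈ (here {cs = cs} i j _ u∈ v∈) = ∈-leavesL⁺ cs i u∈ , ∈-leavesL⁺ cs j v∈
    LcaJoin⇒∈ (there uv)                   = Any-LcaJoin⇒∈ uv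

    Any-LcaJoin⇒∈ : ∀ {cs : List (Cotree n)} {u v} → Any (λ c → LcaJoin c u v) cs →
                    u ∈ leavesL cs × v ∈ leavesL cs
    Any-LcaJoin⇒∈         (here uv)  = Product.map ∈-++⁺ˡ ∈-++⁺ˡ (LcaJoin⇒∈ uv)
    Any-LcaJoin⇒∈ {c ∷ _} (there uv) =
      Product.map (∈-++⁺ʳ (leaves c)) (∈-++⁺ʳ (leaves c)) (Any-LcaJoin⇒∈ uv)

  mutual
    LcaJoin-sym : ∀ {S : Cotree n} {u v} → LcaJoin S u v → LcaJoin S v u
    LcaJoin-sym (here i j i≢j u∈ v∈) = here j i (i≢j ∘ sym) v∈ u∈
    LcaJoin-sym (there uv)           = there (Any-LcaJoin-sym uv)

    Any-LcaJoin-sym : ∀ {cs : List (Cotree n)} {u v} →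
                      Any (λ c → LcaJoin c u v) cs → Any (λ c → LcaJoin c v u) cs
    Any-LcaJoin-sym (here uv)  = here (LcaJoin-sym uv)
    Any-LcaJoin-sym (there uv) = there (Any-LcaJoin-sym uv)

  record _⊑_ (S′ S : Cotree n) : Set where
    field
      leaves⊆  : leaves S′ ⊆ leaves S
      LcaJoin⁺ : ∀ {u v} → LcaJoin S′ u v → LcaJoin S u v
      LcaJoin⁻ : ∀ {u v} → u ∈ leaves S′ → v ∈ leaves S′ → LcaJoin S u v → LcaJoin S′ u v
  open _⊑_ public

  child⊑ : ∀ {k cs} → Unique (leavesL cs) → ∀ i → lookup cs i ⊑ node k cs
  child⊑ {cs = cs} un i = record
    { leaves⊆  = ∈-leavesL⁺ cs i
    ; LcaJoin⁺ = λ uv → there (lose (∈-lookup {xs = cs} i) uv)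
    ; LcaJoin⁻ = restrict
    }
    where
    restrict : ∀ {k u v} → u ∈ leaves (lookup cs i) → v ∈ leaves (lookup cs i) →
               LcaJoin (node k cs) u v → LcaJoin (lookup cs i) u v
    restrict u∈ v∈ (here i′ j′ i′≢j′ u∈′ v∈′) =
      ⊥-elim (i′≢j′ (trans (childIndex-unique cs un u∈′ u∈) (childIndex-unique cs un v∈ v∈′)))
    restrict u∈ _ (there uv) =
      subst (λ j → LcaJoin (lookup cs j) _ _)
            (childIndex-unique cs un (proj₁ (LcaJoin⇒∈ (lookup-index uv))) u∈)
            (lookup-index uv)

  tail⊑ : ∀ {k} c cs → Unique (leavesL (c ∷ cs)) → node k cs ⊑ node k (c ∷ cs)
  tail⊑ c cs un = record
    { leaves⊆  = ∈-++⁺ʳ (leaves c)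
    ; LcaJoin⁺ = extend
    ; LcaJoin⁻ = restrict
    }
    where
    extend : ∀ {k u v} → LcaJoin (node k cs) u v → LcaJoin (node k (c ∷ cs)) u v
    extend (here i j i≢j u∈ v∈) = here (suc i) (suc j) (i≢j ∘ Fin.suc-injective) u∈ v∈
    extend (there uv)           = there (there uv)

    restrict : ∀ {k u v} → u ∈ leavesL cs → v ∈ leavesL cs →
               LcaJoin (node k (c ∷ cs)) u v → LcaJoin (node k cs) u v
    restrict u∈ _  (here zero _ _ u∈c _)            = ⊥-elim (head#tail c cs un (u∈c , u∈))
    restrict _  v∈ (here (suc _) zero _ _ v∈c)      = ⊥-elim (head#tail c cs un (v∈c , v∈))
    restrict _  _  (here (suc i) (suc j) i≢j u∈ v∈) = here i j (i≢j ∘ cong suc) u∈ v∈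
    restrict u∈ _  (there (here uv))                =
      ⊥-elim (head#tail c cs un (proj₁ (LcaJoin⇒∈ uv) , u∈))
    restrict _  _  (there (there uv))               = there uv

  LcaJoin-join-head-tail : ∀ {c cs u v} → u ∈ leaves c → v ∈ leavesL {n} cs →
                           LcaJoin (node join (c ∷ cs)) u v
  LcaJoin-join-head-tail {cs = cs} u∈c v∈cs with ∈-leavesL⁻ cs v∈cs
  ... | j , v∈j = here zero (suc j) (λ ()) u∈c v∈j

  ¬LcaJoin-union-head-tail : ∀ c cs → Unique (leavesL (c ∷ cs)) → ∀ {u v} →
                             u ∈ leaves c → v ∈ leavesL cs → ¬ LcaJoin (node union (c ∷ cs)) u v
  ¬LcaJoin-union-head-tail c cs un _   v∈cs (there (here uv))  =
    head#tail c cs un (proj₂ (LcaJoin⇒∈ uv) , v∈cs)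
  ¬LcaJoin-union-head-tail c cs un u∈c _    (there (there uv)) =
    head#tail c cs un (u∈c , proj₁ (Any-LcaJoin⇒∈ uv))

  record Independent (S : Cotree n) (xs : List (Fin n)) : Set where
    field
      unique      : Unique xs
      ⊆leaves     : xs ⊆ leaves S
      nonadjacent : ∀ {u v} → u ∈ xs → v ∈ xs → ¬ LcaJoin S u v
  open Independent public

  Independent-[] : ∀ {S} → Independent S []
  Independent-[] = record { unique = [] ; ⊆leaves = λ () ; nonadjacent = λ () }

  Independent-⊑ : ∀ {S′ S xs} → S′ ⊑ S → Independent S′ xs → Independent S xs
  Independent-⊑ S′⊑S I = record
    { unique      = unique I
    ; ⊆leaves     = leaves⊆ S′⊑S ∘ ⊆leaves I
    ; nonadjacent = λ u∈ v∈ → nonadjacent I u∈ v∈ ∘ LcaJoin⁻ S′⊑S (⊆leaves I u∈) (⊆leaves I v∈)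
    }

  Independent-++ : ∀ {S xs ys} → Independent S xs → Independent S ys →
                   (∀ {u v} → u ∈ xs → v ∈ ys → u ≢ v × ¬ LcaJoin S u v) →
                   Independent S (xs ++ ys)
  Independent-++ {S} {xs} {ys} Ixs Iys separated = record
    { unique      = Unique.++⁺ (unique Ixs) (unique Iys)
                               (λ (v∈xs , v∈ys) → proj₁ (separated v∈xs v∈ys) refl)
    ; ⊆leaves     = [ ⊆leaves Ixs , ⊆leaves Iys ]′ ∘ ∈-++⁻ xs
    ; nonadjacent = λ u∈ v∈ → nonadjacent-++ (∈-++⁻ xs u∈) (∈-++⁻ xs v∈)
    }
    where
    nonadjacent-++ : ∀ {u v} → u ∈ xs ⊎ u ∈ ys → v ∈ xs ⊎ v ∈ ys → ¬ LcaJoin S u v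
    nonadjacent-++ (inj₁ u∈) (inj₁ v∈) = nonadjacent Ixs u∈ v∈
    nonadjacent-++ (inj₁ u∈) (inj₂ v∈) = proj₂ (separated u∈ v∈)
    nonadjacent-++ (inj₂ u∈) (inj₁ v∈) = proj₂ (separated v∈ u∈) ∘ LcaJoin-sym
    nonadjacent-++ (inj₂ u∈) (inj₂ v∈) = nonadjacent Iys u∈ v∈

  mutual
    α : Cotree n → ℕ
    α (leaf _)        = 1
    α (node union cs) = αSum cs
    α (node join cs)  = αMax cs

    αSum : List (Cotree n) → ℕ
    αSum []       = 0
    αSum (c ∷ cs) = α c + αSum cs

    αMax : List (Cotree n) → ℕ
    αMax []       = 0
    αMax (c ∷ cs) = α c ⊔ αMax cs

  mutual
    independentSet : ∀ S → Unique (leaves S) → ∃ λ xs → Independent S xs × α S ≤ length xs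
    independentSet (leaf v) _ =
      v ∷ [] , record { unique = All.[] ∷ [] ; ⊆leaves = id ; nonadjacent = λ _ _ () } , ≤-refl
    independentSet (node union cs) = independentSetᵁ cs
    independentSet (node join cs)  = independentSetᴶ cs

    independentSetᵁ : ∀ cs → Unique (leavesL cs) →
                      ∃ λ xs → Independent (node union cs) xs × αSum cs ≤ length xs
    independentSetᵁ []       _  = [] , Independent-[] , z≤n
    independentSetᵁ (c ∷ cs) un
      with independentSet c (head-unique c cs un) | independentSetᵁ cs (tail-unique c cs un)
    ... | xs , Ixs , αc≤xs | ys , Iys , αcs≤ys =
      xs ++ ys ,
      Independent-++ (Independent-⊑ (child⊑ un zero) Ixs) (Independent-⊑ (tail⊑ c cs un) Iys) separated ,
      subst (α c + αSum cs ≤_) (sym (length-++ xs)) (+-mono-≤ αc≤xs αcs≤ys)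
      where
      separated : ∀ {u v} → u ∈ xs → v ∈ ys → u ≢ v × ¬ LcaJoin (node union (c ∷ cs)) u v
      separated u∈ v∈ =
        (λ { refl → head#tail c cs un (⊆leaves Ixs u∈ , ⊆leaves Iys v∈) }) ,
        ¬LcaJoin-union-head-tail c cs un (⊆leaves Ixs u∈) (⊆leaves Iys v∈)

    independentSetᴶ : ∀ cs → Unique (leavesL cs) →
                      ∃ λ xs → Independent (node join cs) xs × αMax cs ≤ length xs
    independentSetᴶ []       _  = [] , Independent-[] , z≤n
    independentSetᴶ (c ∷ cs) un with α c ≤? αMax cs
    ... | yes αc≤αcs with independentSetᴶ cs (tail-unique c cs un)
    ...   | xs , Ixs , αcs≤xs =
      xs , Independent-⊑ (tail⊑ c cs un) Ixs , ⊔-lub (≤-trans αc≤αcs αcs≤xs) αcs≤xs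
    independentSetᴶ (c ∷ cs) un | no αc≰αcs with independentSet c (head-unique c cs un)
    ...   | xs , Ixs , αc≤xs =
      xs , Independent-⊑ (child⊑ un zero) Ixs , ⊔-lub αc≤xs (≤-trans (≰⇒≥ αc≰αcs) αc≤xs)

  mutual
    cliqueCover : Cotree n → Fin n → ℕ
    cliqueCover (leaf _)        _ = 0
    cliqueCover (node union cs)   = cliqueCoverᵁ cs
    cliqueCover (node join cs)    = cliqueCoverᴶ cs

    cliqueCoverᵁ : List (Cotree n) → Fin n → ℕ
    cliqueCoverᵁ []       _ = 0
    cliqueCoverᵁ (c ∷ cs) v =
      if does (v ∈? leaves c) then cliqueCover c v else α c + cliqueCoverᵁ cs v

    cliqueCoverᴶ : List (Cotree n) → Fin n → ℕ
    cliqueCoverᴶ []       _ = 0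
    cliqueCoverᴶ (c ∷ cs) v =
      if does (v ∈? leaves c) then cliqueCover c v else cliqueCoverᴶ cs v

  mutual
    cliqueCover<α : ∀ S {v} → v ∈ leaves S → cliqueCover S v < α S
    cliqueCover<α (leaf _)        _ = s≤s z≤n
    cliqueCover<α (node union cs)   = cliqueCoverᵁ<αSum cs
    cliqueCover<α (node join cs)    = cliqueCoverᴶ<αMax cs

    cliqueCoverᵁ<αSum : ∀ cs {v} → v ∈ leavesL cs → cliqueCoverᵁ cs v < αSum cs
    cliqueCoverᵁ<αSum (c ∷ cs) {v} v∈ with v ∈? leaves c
    ... | yes v∈c = <-≤-trans (cliqueCover<α c v∈c) (m≤m+n (α c) (αSum cs))
    ... | no  v∉c = +-monoʳ-< (α c) (cliqueCoverᵁ<αSum cs (∈-++-∉ˡ (leaves c) v∈ v∉c))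

    cliqueCoverᴶ<αMax : ∀ cs {v} → v ∈ leavesL cs → cliqueCoverᴶ cs v < αMax cs
    cliqueCoverᴶ<αMax (c ∷ cs) {v} v∈ with v ∈? leaves c
    ... | yes v∈c = <-≤-trans (cliqueCover<α c v∈c) (m≤m⊔n (α c) (αMax cs))
    ... | no  v∉c =
      <-≤-trans (cliqueCoverᴶ<αMax cs (∈-++-∉ˡ (leaves c) v∈ v∉c)) (m≤n⊔m (α c) (αMax cs))

  mutual
    cliqueCover-clique : ∀ S → Unique (leaves S) → ∀ {u w} → u ∈ leaves S → w ∈ leaves S → u ≢ w →
                         cliqueCover S u ≡ cliqueCover S w → LcaJoin S u w
    cliqueCover-clique (leaf _) _ (here refl) (here refl) u≢w _ = ⊥-elim (u≢w refl)
    cliqueCover-clique (node union cs) = cliqueCoverᵁ-clique cs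
    cliqueCover-clique (node join cs)  = cliqueCoverᴶ-clique cs

    cliqueCoverᵁ-clique : ∀ cs → Unique (leavesL cs) → ∀ {u w} → u ∈ leavesL cs → w ∈ leavesL cs →
                          u ≢ w → cliqueCoverᵁ cs u ≡ cliqueCoverᵁ cs w → LcaJoin (node union cs) u w
    cliqueCoverᵁ-clique (c ∷ cs) un {u} {w} u∈ w∈ u≢w eq with u ∈? leaves c | w ∈? leaves c
    ... | yes u∈c | yes w∈c = there (here (cliqueCover-clique c (head-unique c cs un) u∈c w∈c u≢w eq))
    ... | yes u∈c | no  _   =
      ⊥-elim (<⇒≱ (cliqueCover<α c u∈c) (subst (α c ≤_) (sym eq) (m≤m+n (α c) _)))
    ... | no  _   | yes w∈c =
      ⊥-elim (<⇒≱ (cliqueCover<α c w∈c) (subst (α c ≤_) eq (m≤m+n (α c) _)))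
    ... | no  u∉c | no  w∉c = LcaJoin⁺ (tail⊑ c cs un)
      (cliqueCoverᵁ-clique cs (tail-unique c cs un) (∈-++-∉ˡ (leaves c) u∈ u∉c)
                           (∈-++-∉ˡ (leaves c) w∈ w∉c) u≢w (+-cancelˡ-≡ (α c) _ _ eq))

    cliqueCoverᴶ-clique : ∀ cs → Unique (leavesL cs) → ∀ {u w} → u ∈ leavesL cs → w ∈ leavesL cs →
                          u ≢ w → cliqueCoverᴶ cs u ≡ cliqueCoverᴶ cs w → LcaJoin (node join cs) u w
    cliqueCoverᴶ-clique (c ∷ cs) un {u} {w} u∈ w∈ u≢w eq with u ∈? leaves c | w ∈? leaves c
    ... | yes u∈c | yes w∈c = there (here (cliqueCover-clique c (head-unique c cs un) u∈c w∈c u≢w eq))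
    ... | yes u∈c | no  w∉c = LcaJoin-join-head-tail u∈c (∈-++-∉ˡ (leaves c) w∈ w∉c)
    ... | no  u∉c | yes w∈c = LcaJoin-sym (LcaJoin-join-head-tail w∈c (∈-++-∉ˡ (leaves c) u∈ u∉c))
    ... | no  u∉c | no  w∉c = LcaJoin⁺ (tail⊑ c cs un)
      (cliqueCoverᴶ-clique cs (tail-unique c cs un) (∈-++-∉ˡ (leaves c) u∈ u∉c)
                           (∈-++-∉ˡ (leaves c) w∈ w∉c) u≢w eq)

  record InducedKtt (t : ℕ) (S : Cotree n) : Set where
    field
      left right        : List (Fin n)
      left-independent  : Independent S left
      right-independent : Independent S right
      t≤left            : t ≤ length left
      t≤right           : t ≤ length right
      disjoint          : Disjoint left right
      complete          : ∀ {u v} → u ∈ left → v ∈ right → LcaJoin S u v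

  InducedKtt-⊑ : ∀ {t S′ S} → S′ ⊑ S → InducedKtt t S′ → InducedKtt t S
  InducedKtt-⊑ S′⊑S K = record
    { left              = left
    ; right             = right
    ; left-independent  = Independent-⊑ S′⊑S left-independent
    ; right-independent = Independent-⊑ S′⊑S right-independent
    ; t≤left            = t≤left
    ; t≤right           = t≤right
    ; disjoint          = disjoint
    ; complete          = λ u∈ v∈ → LcaJoin⁺ S′⊑S (complete u∈ v∈)
    }
    where open InducedKtt K

  bigChildren⇒InducedKtt : ∀ {t} cs → Unique (leavesL cs) → ∀ {i j} → i ≢ j →
                           t ≤ α (lookup cs i) → t ≤ α (lookup cs j) → InducedKtt t (node join cs)
  bigChildren⇒InducedKtt cs un {i} {j} i≢j t≤αi t≤αj
    with independentSet (lookup cs i) (child-unique cs un i)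
       | independentSet (lookup cs j) (child-unique cs un j)
  ... | xs , Ixs , αi≤xs | ys , Iys , αj≤ys = record
    { left              = xs
    ; right             = ys
    ; left-independent  = Independent-⊑ (child⊑ un i) Ixs
    ; right-independent = Independent-⊑ (child⊑ un j) Iys
    ; t≤left            = ≤-trans t≤αi αi≤xs
    ; t≤right           = ≤-trans t≤αj αj≤ys
    ; disjoint          = λ (v∈xs , v∈ys) →
                            i≢j (childIndex-unique cs un (⊆leaves Ixs v∈xs) (⊆leaves Iys v∈ys))
    ; complete          = λ u∈ v∈ → here i j i≢j (⊆leaves Ixs u∈) (⊆leaves Iys v∈)
    }

  atMostOneBigChild : ∀ {t} cs → Unique (leavesL cs) → ¬ InducedKtt t (node join cs) →
                      ∀ {i j} → t ≤ α (lookup cs i) → t ≤ α (lookup cs j) → i ≡ j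
  atMostOneBigChild cs un noKtt {i} {j} t≤αi t≤αj =
    decidable-stable (i Fin.≟ j) (λ i≢j → noKtt (bigChildren⇒InducedKtt cs un i≢j t≤αi t≤αj))

  byChild : ∀ cs → (Fin (length cs) → Fin n → ℕ) → Fin n → ℕ
  byChild []       _  _ = 0
  byChild (c ∷ cs) κs v = if does (v ∈? leaves c) then κs zero v else byChild cs (κs ∘ suc) v

  byChild-lookup : ∀ cs κs → Unique (leavesL cs) → ∀ {i v} →
                   v ∈ leaves (lookup cs i) → byChild cs κs v ≡ κs i v
  byChild-lookup (c ∷ cs) κs un {zero} {v} v∈c with v ∈? leaves c
  ... | yes _   = refl
  ... | no  v∉c = ⊥-elim (v∉c v∈c)
  byChild-lookup (c ∷ cs) κs un {suc i} {v} v∈i with v ∈? leaves c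
  ... | yes v∈c = ⊥-elim (head#tail c cs un (v∈c , ∈-leavesL⁺ cs i v∈i))
  ... | no  _   = byChild-lookup cs (κs ∘ suc) (tail-unique c cs un) v∈i

  byChild-≡ : ∀ cs κs → Unique (leavesL cs) → ∀ {i j u v} →
              u ∈ leaves (lookup cs i) → v ∈ leaves (lookup cs j) →
              byChild cs κs u ≡ byChild cs κs v → κs i u ≡ κs j v
  byChild-≡ cs κs un u∈ v∈ eq =
    trans (sym (byChild-lookup cs κs un u∈)) (trans eq (byChild-lookup cs κs un v∈))

  byChild-bounded : ∀ {k} cs κs → Unique (leavesL cs) →
                    (∀ i {v} → v ∈ leaves (lookup cs i) → κs i v < k) →
                    ∀ {v} → v ∈ leavesL cs → byChild cs κs v < k
  byChild-bounded cs κs un bounded v∈ with ∈-leavesL⁻ cs v∈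
  ... | i , v∈i = subst (_< _) (sym (byChild-lookup cs κs un v∈i)) (bounded i v∈i)

  -- A graph is a cluster graph iff it has no induced path on three vertices.
  ClassesTransitive : Cotree n → (Fin n → ℕ) → Set
  ClassesTransitive S κ = ∀ {u v w} → κ u ≡ κ v → κ v ≡ κ w → u ≢ w →
                          LcaJoin S u v → LcaJoin S v w → LcaJoin S u w

  record Subcolouring (k : ℕ) (S : Cotree n) (κ : Fin n → ℕ) : Set where
    field
      bounded    : ∀ {v} → v ∈ leaves S → κ v < k
      transitive : ClassesTransitive S κ
  open Subcolouring public

  union-path : ∀ cs → Unique (leavesL cs) → ∀ {u v w} →
               LcaJoin (node union cs) u v → LcaJoin (node union cs) v w →
               ∃ λ i → LcaJoin (lookup cs i) u v × LcaJoin (lookup cs i) v w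
  union-path cs un (there uv) (there vw) =
    index uv , lookup-index uv ,
    subst (λ i → LcaJoin (lookup cs i) _ _)
          (childIndex-unique cs un (proj₁ (LcaJoin⇒∈ (lookup-index vw)))
                                   (proj₂ (LcaJoin⇒∈ (lookup-index uv))))
          (lookup-index vw)

  union-subcolouring : ∀ {k} cs κs → Unique (leavesL cs) →
                       (∀ i → Subcolouring k (lookup cs i) (κs i)) →
                       Subcolouring k (node union cs) (byChild cs κs)
  union-subcolouring cs κs un sub = record
    { bounded    = byChild-bounded cs κs un (bounded ∘ sub)
    ; transitive = transitive-byChild
    }
    where
    transitive-byChild : ClassesTransitive (node union cs) (byChild cs κs)
    transitive-byChild κu≡κv κv≡κw u≢w uv vw with union-path cs un uv vw
    ... | i , uv′ , vw′ with LcaJoin⇒∈ uv′ | LcaJoin⇒∈ vw′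
    ...   | u∈ , v∈ | _ , w∈ = LcaJoin⁺ (child⊑ un i)
      (transitive (sub i) (byChild-≡ cs κs un u∈ v∈ κu≡κv) (byChild-≡ cs κs un v∈ w∈ κv≡κw)
                  u≢w uv′ vw′)

module _ {n : ℕ} (t : ℕ) where

  data JoinPart (m k : ℕ) (c : Cotree n) (κ : Fin n → ℕ) : Set where
    big   : t ≤ α c → Subcolouring m c κ → JoinPart m k c κ
    small : (∀ {v} → v ∈ leaves c → m ≤ κ v × κ v < k) →
            (∀ {u w} → u ∈ leaves c → w ∈ leaves c → u ≢ w → κ u ≡ κ w → LcaJoin c u w) →
            JoinPart m k c κ

  join-subcolouring : ∀ {m k} cs κs → Unique (leavesL cs) → m ≤ k →
                      (∀ {i j} → t ≤ α (lookup cs i) → t ≤ α (lookup cs j) → i ≡ j) →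
                      (∀ i → JoinPart m k (lookup cs i) (κs i)) →
                      Subcolouring k (node join cs) (byChild cs κs)
  join-subcolouring {m} {k} cs κs un m≤k oneBig part = record
    { bounded    = byChild-bounded cs κs un (λ i → part-bounded (part i))
    ; transitive = transitive-byChild
    }
    where
    part-bounded : ∀ {c κ v} → JoinPart m k c κ → v ∈ leaves c → κ v < k
    part-bounded (big _ sub)     v∈ = <-≤-trans (bounded sub v∈) m≤k
    part-bounded (small range _) v∈ = proj₂ (range v∈)

    below≢above : ∀ {a b} → a < m → m ≤ b → a ≢ b
    below≢above a<m m≤b = <⇒≢ (<-≤-trans a<m m≤b)

    _∈ᶜ_ : Fin n → Fin (length cs) → Set
    v ∈ᶜ i = v ∈ leaves (lookup cs i)

    Part : Fin (length cs) → Set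
    Part i = JoinPart m k (lookup cs i) (κs i)

    transitive-located : ∀ {i j l u v w} → u ∈ᶜ i → v ∈ᶜ j → w ∈ᶜ l →
                         κs i u ≡ κs j v → κs j v ≡ κs l w → u ≢ w →
                         LcaJoin (node join cs) u v → LcaJoin (node join cs) v w →
                         Part i → Part j → Part l → LcaJoin (node join cs) u w
    transitive-located {i} u∈ v∈ w∈ κu≡κv κv≡κw u≢w uv vw (big t≤i sub) (big t≤j _) (big t≤l _)
      with oneBig t≤i t≤j | oneBig t≤j t≤l
    ... | refl | refl = LcaJoin⁺ (child⊑ un i)
      (transitive sub κu≡κv κv≡κw u≢w (LcaJoin⁻ (child⊑ un i) u∈ v∈ uv) (LcaJoin⁻ (child⊑ un i) v∈ w∈ vw))
    transitive-located u∈ v∈ _ κu≡κv _ _ _ _ (big _ subᵤ) (small rangeᵥ _) _ =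
      ⊥-elim (below≢above (bounded subᵤ u∈) (proj₁ (rangeᵥ v∈)) κu≡κv)
    transitive-located _ v∈ w∈ _ κv≡κw _ _ _ (big _ _) (big _ subᵥ) (small rangeʷ _) =
      ⊥-elim (below≢above (bounded subᵥ v∈) (proj₁ (rangeʷ w∈)) κv≡κw)
    transitive-located u∈ _ w∈ κu≡κv κv≡κw _ _ _ (small rangeᵤ _) _ (big _ subʷ) =
      ⊥-elim (below≢above (bounded subʷ w∈) (proj₁ (rangeᵤ u∈)) (sym (trans κu≡κv κv≡κw)))
    transitive-located {i} {_} {l} u∈ _ w∈ κu≡κv κv≡κw u≢w _ _ (small _ clique) _ (small _ _)
      with i Fin.≟ l
    ... | yes refl = LcaJoin⁺ (child⊑ un i) (clique u∈ w∈ u≢w (trans κu≡κv κv≡κw))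
    ... | no  i≢l  = here i l i≢l u∈ w∈

    transitive-byChild : ClassesTransitive (node join cs) (byChild cs κs)
    transitive-byChild κu≡κv κv≡κw u≢w uv vw
      with ∈-leavesL⁻ cs (proj₁ (LcaJoin⇒∈ uv))
         | ∈-leavesL⁻ cs (proj₁ (LcaJoin⇒∈ vw))
         | ∈-leavesL⁻ cs (proj₂ (LcaJoin⇒∈ vw))
    ... | i , u∈ | j , v∈ | l , w∈ =
      transitive-located u∈ v∈ w∈ (byChild-≡ cs κs un u∈ v∈ κu≡κv) (byChild-≡ cs κs un v∈ w∈ κv≡κw)
                         u≢w uv vw (part i) (part j) (part l)

  colours : ℕ → ℕ
  colours d = 1 + (d ∸ 1) * (t ∸ 1)

  colours-mono : ∀ e → colours e ≤ colours (suc e)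
  colours-mono e = s≤s (*-monoˡ-≤ (t ∸ 1) (m∸n≤m e 1))

  colours-suc : ∀ {e} → 1 ≤ e → colours e + (t ∸ 1) ≡ colours (suc e)
  colours-suc {suc e} _ = cong suc (+-comm (e * (t ∸ 1)) (t ∸ 1))

  joinPart : ∀ {e κ} c → Unique (leaves c) → 1 ≤ e → Subcolouring (colours e) c κ →
             ∃ (JoinPart (colours e) (colours (suc e)) c)
  joinPart {e} {κ} c un 1≤e sub with t ≤? α c
  ... | yes t≤αc = κ , big t≤αc sub
  ... | no  t≰αc = κ′ , small range clique
    where
    κ′ : Fin n → ℕ
    κ′ v = colours e + cliqueCover c v

    range : ∀ {v} → v ∈ leaves c → colours e ≤ κ′ v × κ′ v < colours (suc e)
    range v∈ = m≤m+n _ _ , <-≤-trans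
      (+-monoʳ-< (colours e) (<-≤-trans (cliqueCover<α c v∈) (∸-monoˡ-≤ 1 (≰⇒> t≰αc))))
      (≤-reflexive (colours-suc 1≤e))

    clique : ∀ {u w} → u ∈ leaves c → w ∈ leaves c → u ≢ w → κ′ u ≡ κ′ w → LcaJoin c u w
    clique u∈ w∈ u≢w eq = cliqueCover-clique c un u∈ w∈ u≢w (+-cancelˡ-≡ (colours e) _ _ eq)

  mutual
    subcolouring : ∀ d S → Unique (leaves S) → depth S ≤ d → ¬ InducedKtt t S →
                   ∃ (Subcolouring (colours d) S)
    subcolouring d (leaf _) _ _ _ =
      (λ _ → 0) , record { bounded = λ _ → s≤s z≤n ; transitive = λ _ _ _ () }
    subcolouring d (node union cs) un depth≤d noKtt =
      byChild cs (proj₁ ∘ child) , union-subcolouring cs (proj₁ ∘ child) un (proj₂ ∘ child)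
      where
      child : ∀ i → ∃ (Subcolouring (colours d) (lookup cs i))
      child i = subcolouringᴸ d cs i (child-unique cs un i)
                  (≤-trans (depth-lookup cs i) (≤-trans (n≤1+n _) depth≤d))
                  (noKtt ∘ InducedKtt-⊑ (child⊑ un i))
    subcolouring (suc e) (node join cs) un (s≤s depth≤e) noKtt =
      byChild cs (proj₁ ∘ part) ,
      join-subcolouring cs (proj₁ ∘ part) un (colours-mono e) (atMostOneBigChild cs un noKtt)
                        (proj₂ ∘ part)
      where
      depth-child≤e : ∀ i → depth (lookup cs i) ≤ e
      depth-child≤e i = ≤-trans (depth-lookup cs i) depth≤e

      part : ∀ i → ∃ (JoinPart (colours e) (colours (suc e)) (lookup cs i))
      part i = joinPart (lookup cs i) (child-unique cs un i) (≤-trans (depth≥1 _) (depth-child≤e i))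
        (proj₂ (subcolouringᴸ e cs i (child-unique cs un i) (depth-child≤e i)
                              (noKtt ∘ InducedKtt-⊑ (child⊑ un i))))

    subcolouringᴸ : ∀ d cs i → Unique (leaves (lookup cs i)) → depth (lookup cs i) ≤ d →
                    ¬ InducedKtt t (lookup cs i) → ∃ (Subcolouring (colours d) (lookup cs i))
    subcolouringᴸ d (c ∷ _)  zero    = subcolouring d c
    subcolouringᴸ d (_ ∷ cs) (suc i) = subcolouringᴸ d cs i

module _ {n : ℕ} (G : Graph n) where

  ConnIn-head : ∀ {P u v} → ConnIn G P u v → P u
  ConnIn-head (refl pu)     = pu
  ConnIn-head (step pu _ _) = pu

  ConnIn-last : ∀ {P u v} → ConnIn G P u v → P v
  ConnIn-last (refl pv)       = pv
  ConnIn-last (step _ _ path) = ConnIn-last path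

  transitive⇒cluster : ∀ P →
                       (∀ {u v w} → P u → P v → P w → u ≢ w → E G u v → E G v w → E G u w) →
                       IsClusterGraphOn G P
  transitive⇒cluster P closed u w u≢w (refl _) = ⊥-elim (u≢w refl)
  transitive⇒cluster P closed u w u≢w (step {v = v} pu uv path) with v Fin.≟ w
  ... | yes refl = uv
  ... | no  v≢w  = closed pu (ConnIn-head path) (ConnIn-last path) u≢w uv
                          (transitive⇒cluster P closed v w v≢w path)

  module _ {T : Cotree n} (isCotree : IsCotree G T) where
    open import Data.List.Relation.Binary.Permutation.Setoid.Properties (setoid (Fin n))
      using (Unique-resp-↭)

    leaves-unique : Unique (leaves T)
    leaves-unique = Unique-resp-↭ (↭⇒↭ₛ (↭-sym (proj₁ isCotree))) (Unique.allFin⁺ n)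

    ∈-leaves : ∀ v → v ∈ leaves T
    ∈-leaves v = ∈-resp-↭ (↭-sym (proj₁ isCotree)) (∈-allFin v)

    E⇒LcaJoin : ∀ {u v} → E G u v → LcaJoin T u v
    E⇒LcaJoin {u} {v} uv = Equivalence.to (proj₂ isCotree u v (λ { refl → irrefl G uv })) uv

    LcaJoin⇒E : ∀ {u v} → u ≢ v → LcaJoin T u v → E G u v
    LcaJoin⇒E {u} {v} u≢v = Equivalence.from (proj₂ isCotree u v u≢v)

    subcolouring⇒subchromatic : ∀ {k κ} → Subcolouring k T κ → SubchromaticAtMost k G
    subcolouring⇒subchromatic {k} {κ} sub =
      colour , λ i → transitive⇒cluster (λ v → colour v ≡ i) closed
      where
      colour : Fin n → Fin k
      colour v = Fin.fromℕ< (bounded sub (∈-leaves v))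

      colour≡⇒κ≡ : ∀ {u v} → colour u ≡ colour v → κ u ≡ κ v
      colour≡⇒κ≡ eq = trans (sym (Fin.toℕ-fromℕ< _)) (trans (cong Fin.toℕ eq) (Fin.toℕ-fromℕ< _))

      closed : ∀ {i u v w} → colour u ≡ i → colour v ≡ i → colour w ≡ i → u ≢ w →
               E G u v → E G v w → E G u w
      closed cu cv cw u≢w uv vw = LcaJoin⇒E u≢w
        (transitive sub (colour≡⇒κ≡ (trans cu (sym cv))) (colour≡⇒κ≡ (trans cv (sym cw)))
                    u≢w (E⇒LcaJoin uv) (E⇒LcaJoin vw))

    InducedKtt⇒ContainsInducedKtt : ∀ {t} → InducedKtt t T → ContainsInducedKtt t G
    InducedKtt⇒ContainsInducedKtt {t} K =
      a , b , injective left-independent t≤left , injective right-independent t≤right , a≢b ,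
      (λ _ _ _ → nonadjacent left-independent (∈-lookup _) (∈-lookup _) ∘ E⇒LcaJoin) ,
      (λ _ _ _ → nonadjacent right-independent (∈-lookup _) (∈-lookup _) ∘ E⇒LcaJoin) ,
      (λ i j → LcaJoin⇒E (a≢b i j) (complete (∈-lookup _) (∈-lookup _)))
      where
      open InducedKtt K

      a b : Fin t → Fin n
      a i = lookup left  (Fin.inject≤ i t≤left)
      b j = lookup right (Fin.inject≤ j t≤right)

      injective : ∀ {xs} → Independent T xs → (t≤ : t ≤ length xs) → ∀ i j →
                  lookup xs (Fin.inject≤ i t≤) ≡ lookup xs (Fin.inject≤ j t≤) → i ≡ j
      injective I t≤ i j = Fin.inject≤-injective t≤ t≤ i j ∘ Unique⇒lookup-injective (unique I) _ _

      a≢b : ∀ i j → a i ≢ b j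
      a≢b i j eq = disjoint (∈-lookup _ , subst (_∈ right) (sym eq) (∈-lookup _))

-- The argument does not use the hypotheses 1 ≤ d and 1 ≤ t.
lemma3p6 : (d t : ℕ) → 1 ≤ d → 1 ≤ t → (n : ℕ) → (G : Graph n) →
    CographOfDepthAtMost d G → ¬ ContainsInducedKtt t G →
    SubchromaticAtMost (1 + (d ∸ 1) * (t ∸ 1)) G
lemma3p6 d t _ _ n G (T , isCotree , depth≤d) noKtt =
  subcolouring⇒subchromatic G isCotree
    (proj₂ (subcolouring t d T (leaves-unique G isCotree) depth≤d
                         (noKtt ∘ InducedKtt⇒ContainsInducedKtt G isCotree)))
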